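{- Let $\varphi:F'\to F$ be a homomorphism of tracts and let $A$ be an $m\times n$ matrix with entries in $F$. Then \[ r_{\mathrm{mat}}(\varphi^{ -1}(A)) \ge r_{\varphi\text{ - }\mathrm{mat}}(A) \ge r_{\mathrm{mat}}(A). \]
   Context: A tract is a multiplicatively written commutative monoid $F$ with an absorbing element $0$ such that $F^\times = F\setminus\{0\}$ is a group, together with a subset $N_F$ (the null set) of the group semiring $\mathbb{N}[F^\times]$ (finite formal sums of elements of $F^\times$), such that: the zero element of $\mathbb{N}[F^\times]$ lies in $N_F$; there is a unique $\epsilon\in F^\times$ with $1+\epsilon\in N_F$ (written $-1$); and $N_F$ is closed under multiplication by elements of $F^\times$. A formal sum $\sum_i x_i$ with $x_i\in F$ is regarded as an element of $\mathbb{N}[F^\times]$ by discarding zero terms. A homomorphism of tracts $\varphi:F'\to F$ is a map with $\varphi(0)=0$ inducing a group homomorphism $(F')^\times\to F^\times$ and with $\varphi(N_{F'})\subseteq N_F$; it is applied to vectors and matrices entrywise. Vectors $X,Y\in F^n$ are orthogonal if $\sum_i X_iY_i\in N_F$. An $F$-matroid $M$ of rank $r$ on $[n]$ is a matroid $\underline{M}$ of rank $r$ on $[n]$ together with subsets $\mathcal{C}(M),\mathcal{C}^*(M)\subseteq F^n$ ($F$-circuits and $F$-cocircuits) such that: (1) both sets are closed under multiplication by $F^\times$; (2) the support of every $F$-circuit is a circuit of $\underline{M}$ and the support of every $F$-cocircuit is a cocircuit of $\underline{M}$; (3) for every circuit (resp. cocircuit) of $\underline{M}$ there is an $F$-circuit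 (resp. $F$-cocircuit) with that support, unique up to multiplication by an element of $F^\times$; (4) every $F$-circuit is orthogonal to every $F$-cocircuit. A covector of $M$ is an $X\in F^n$ orthogonal to every $F$-circuit of $M$. The push-forward $\varphi_*(M')$ of an $F'$-matroid $M'$ is the $F$-matroid with the same underlying matroid whose $F$-circuits (resp. $F$-cocircuits) are the vectors $c\,\varphi(X)$ with $X$ an $F'$-circuit (resp. $F'$-cocircuit) of $M'$ and $c\in F^\times$. The matroidal rank $r_{\mathrm{mat}}(B)$ of an $m\times n$ matrix $B$ over a tract is the minimal rank of a matroid over that tract on $[n]$ having every row of $B$ as a covector. The $\varphi$-matroidal rank $r_{\varphi\text{ - }\mathrm{mat}}(A)$ is the minimal rank of an $F'$-matroid $M'$ on $[n]$ such that every row of $A$ is a covector of $\varphi_*(M')$. A lift of $A$ is a matrix $A'$ over $F'$ with $\varphi(A')=A$; $r_{\mathrm{mat}}(\varphi^{ -1}(A))$ is the minimum of $r_{\mathrm{mat}}(A')$ over all lifts $A'$ of $A$, or $+\infty$ if $A$ has no lift. -}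

module Defs where

open import Data.Nat using (ℕ)
open import Data.Fin using (Fin)
open import Data.Fin.Subset using (Subset; _∈_; _∉_; _⊆_; _∪_; _-_; ⁅_⁆; ∁; ∣_∣)
open import Data.Maybe using (Maybe; just; nothing; is-just)
open import Data.List using (List; []; _∷_; catMaybes)
import Data.List as L
open import Data.List.Relation.Binary.Permutation.Propositional using (_↭_)
open import Data.Vec using (Vec; lookup; toList; zipWith)
import Data.Vec as V
open import Data.Product using (Σ; ∃; ∃-syntax; _×_)
open import Relation.Nullary using (¬_)
open import Relation.Binary.PropositionalEquality using (_≡_; _≢_)

-- A tract F is encoded as F = Maybe U, where U = F^× is an
-- abelian group (written multiplicatively) and nothing = 0 (absorbing).
-- N[F^×] (finite formal sums of units) is encoded as List U, with the
-- null set N required to be invariant under permutation (so it is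
-- really a set of finite multisets).

record Tract : Set₁ where
  field
    U        : Set
    _·_      : U → U → U
    e        : U
    inv      : U → U
    ·-assoc  : ∀ x y z → (x · y) · z ≡ x · (y · z)
    ·-comm   : ∀ x y → x · y ≡ y · x
    ·-idˡ    : ∀ x → e · x ≡ x
    ·-invˡ   : ∀ x → inv x · x ≡ e
    N        : List U → Set
    N-perm   : ∀ {xs ys} → xs ↭ ys → N xs → N ys
    N-zero   : N []
    minus    : U
    minus-N  : N (e ∷ minus ∷ [])
    minus-unique : ∀ ε → N (e ∷ ε ∷ []) → ε ≡ minus
    N-scale  : ∀ c xs → N xs → N (L.map (c ·_) xs)

  Elt : Set
  Elt = Maybe U

  _⋆_ : Elt → Elt → Elt
  just x ⋆ just y = just (x · y)
  _      ⋆ _      = nothing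

open Tract public using (U; Elt)

record TractHom (F' F : Tract) : Set where
  private
    module F' = Tract F'
    module F  = Tract F
  field
    f       : F'.U → F.U
    f-mult  : ∀ x y → f (x F'.· y) ≡ f x F.· f y
    f-N     : ∀ xs → F'.N xs → F.N (L.map f xs)

  apply : Elt F' → Elt F
  apply nothing  = nothing
  apply (just x) = just (f x)

Vector : Tract → ℕ → Set
Vector F n = Vec (Elt F) n

Matrix : Tract → ℕ → ℕ → Set
Matrix F m n = Vec (Vector F n) m

scale : (F : Tract) {n : ℕ} → U F → Vector F n → Vector F n
scale F c X = V.map (λ x → Tract._⋆_ F (just c) x) X

-- ∑ X_i Y_i as an element of N[F^×] (zero terms discarded)
innerSum : (F : Tract) {n : ℕ} → Vector F n → Vector F n → List (U F)
innerSum F X Y = catMaybes (toList (zipWith (Tract._⋆_ F) X Y))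

Orthogonal : (F : Tract) {n : ℕ} → Vector F n → Vector F n → Set
Orthogonal F X Y = Tract.N F (innerSum F X Y)

support : {F : Tract} {n : ℕ} → Vector F n → Subset n
support {F} X = V.map is-just X

record Matroid (n : ℕ) : Set₁ where
  field
    IsBasis     : Subset n → Set
    basis-exists : ∃ IsBasis
    exchange    : ∀ {B₁ B₂} → IsBasis B₁ → IsBasis B₂ →
                  ∀ {x} → x ∈ B₁ → x ∉ B₂ →
                  ∃[ y ] (y ∈ B₂ × y ∉ B₁ × IsBasis ((B₁ - x) ∪ ⁅ y ⁆))

IndepFor : {n : ℕ} → (Subset n → Set) → Subset n → Set
IndepFor IsB I = ∃[ B ] (IsB B × I ⊆ B)

CircuitFor : {n : ℕ} → (Subset n → Set) → Subset n → Set
CircuitFor IsB C = ¬ IndepFor IsB C × (∀ D → D ⊆ C → D ≢ C → IndepFor IsB D)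

IsCircuit : {n : ℕ} → Matroid n → Subset n → Set
IsCircuit M = CircuitFor (Matroid.IsBasis M)

-- cocircuits = circuits of the dual matroid (bases = complements of bases)
IsCocircuit : {n : ℕ} → Matroid n → Subset n → Set
IsCocircuit M = CircuitFor (λ B → Matroid.IsBasis M (∁ B))

MatroidRank : {n : ℕ} → Matroid n → ℕ → Set
MatroidRank M r = ∀ B → Matroid.IsBasis M B → ∣ B ∣ ≡ r

record FMatroid (F : Tract) (n : ℕ) : Set₁ where
  field
    under   : Matroid n
    Circ    : Vector F n → Set
    Cocirc  : Vector F n → Set
    Circ-scale   : ∀ c X → Circ X → Circ (scale F c X)
    Cocirc-scale : ∀ c X → Cocirc X → Cocirc (scale F c X)
    Circ-supp    : ∀ X → Circ X → IsCircuit under (support {F} X)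
    Cocirc-supp  : ∀ X → Cocirc X → IsCocircuit under (support {F} X)
    Circ-exists  : ∀ C → IsCircuit under C → ∃[ X ] (Circ X × support {F} X ≡ C)
    Cocirc-exists : ∀ C → IsCocircuit under C → ∃[ X ] (Cocirc X × support {F} X ≡ C)
    Circ-unique  : ∀ X Y → Circ X → Circ Y → support {F} X ≡ support {F} Y →
                   ∃[ c ] (Y ≡ scale F c X)
    Cocirc-unique : ∀ X Y → Cocirc X → Cocirc Y → support {F} X ≡ support {F} Y →
                   ∃[ c ] (Y ≡ scale F c X)
    orth         : ∀ X Y → Circ X → Cocirc Y → Orthogonal F X Y

FMatroidRank : {F : Tract} {n : ℕ} → FMatroid F n → ℕ → Set
FMatroidRank M r = MatroidRank (FMatroid.under M) r

CovectorOf : (F : Tract) {n : ℕ} → (Vector F n → Set) → Vector F n → Set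
CovectorOf F Circ X = ∀ Y → Circ Y → Orthogonal F X Y

IsCovector : {F : Tract} {n : ℕ} → FMatroid F n → Vector F n → Set
IsCovector {F} M X = CovectorOf F (FMatroid.Circ M) X

-- F-circuits of the push-forward φ_*(M'): vectors c·φ(X), X an F'-circuit
PushCirc : {F' F : Tract} (φ : TractHom F' F) {n : ℕ} → FMatroid F' n →
           Vector F n → Set
PushCirc {F'} {F} φ M' Z =
  ∃[ c ] ∃[ X ] (FMatroid.Circ M' X × Z ≡ scale F c (V.map (TractHom.apply φ) X))

IsPushCovector : {F' F : Tract} (φ : TractHom F' F) {n : ℕ} → FMatroid F' n →
                 Vector F n → Set
IsPushCovector {F'} {F} φ M' X = CovectorOf F (PushCirc φ M') X

-- Matroidal ranks.  Each rank is the minimum of a set of naturals; we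
-- define the predicate "r belongs to that set".

MatRankAttained : {F : Tract} {m n : ℕ} → Matrix F m n → ℕ → Set₁
MatRankAttained {F} {m} {n} B r =
  Σ (FMatroid F n) λ M → FMatroidRank M r × (∀ i → IsCovector M (lookup B i))

PhiMatRankAttained : {F' F : Tract} (φ : TractHom F' F) {m n : ℕ} →
                     Matrix F m n → ℕ → Set₁
PhiMatRankAttained {F'} φ {m} {n} A r =
  Σ (FMatroid F' n) λ M' → FMatroidRank M' r × (∀ i → IsPushCovector φ M' (lookup A i))

IsLift : {F' F : Tract} (φ : TractHom F' F) {m n : ℕ} →
         Matrix F' m n → Matrix F m n → Set
IsLift φ A' A = V.map (V.map (TractHom.apply φ)) A' ≡ A

LiftRankAttained : {F' F : Tract} (φ : TractHom F' F) {m n : ℕ} →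
                   Matrix F m n → ℕ → Set₁
LiftRankAttained {F'} φ {m} {n} A r =
  Σ (Matrix F' m n) λ A' → IsLift φ A' A × MatRankAttained {F'} A' r

-- Both inequalities hold with the same witness rank.  If A' lifts A and M'
-- has the rows of A' as covectors, then the rows of A = φ(A') are covectors
-- of φ_*(M'), because φ maps null sums to null sums.  And φ_*(M') is itself
-- an F-matroid with the same underlying matroid as M', so its rank is that
-- of M'.
module Submission where

open import Defs
open import Data.Nat using (ℕ; _≤_)
open import Data.Nat.Properties using (≤-refl)
open import Data.Fin.Subset using (Subset)
open import Data.Product using (Σ; ∃-syntax; _×_; _,_)
open import Data.Maybe using (just; nothing)
open import Data.Vec using ([]; _∷_; lookup)
import Data.Vec as V
open import Data.Vec.Properties using (lookup-map)
import Data.List as L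
open import Relation.Binary.PropositionalEquality
open ≡-Reasoning

module TractProperties (F : Tract) where
  open Tract F

  ·-idʳ : ∀ x → x · e ≡ x
  ·-idʳ x = trans (·-comm x e) (·-idˡ x)

  ·-interchange : ∀ a b c d → (a · b) · (c · d) ≡ (a · c) · (b · d)
  ·-interchange a b c d = begin
    (a · b) · (c · d)  ≡⟨ ·-assoc a b (c · d) ⟩
    a · (b · (c · d))  ≡⟨ cong (a ·_) (sym (·-assoc b c d)) ⟩
    a · ((b · c) · d)  ≡⟨ cong (λ u → a · (u · d)) (·-comm b c) ⟩
    a · ((c · b) · d)  ≡⟨ cong (a ·_) (·-assoc c b d) ⟩
    a · (c · (b · d))  ≡⟨ sym (·-assoc a c (b · d)) ⟩
    (a · c) · (b · d)  ∎

  scale-scale : ∀ {n} c d (X : Vector F n) → scale F c (scale F d X) ≡ scale F (c · d) X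
  scale-scale c d []           = refl
  scale-scale c d (nothing ∷ X) = cong (nothing ∷_) (scale-scale c d X)
  scale-scale c d (just x ∷ X)  =
    cong₂ _∷_ (cong just (sym (·-assoc c d x))) (scale-scale c d X)

  scale-identity : ∀ {n} (X : Vector F n) → scale F e X ≡ X
  scale-identity []            = refl
  scale-identity (nothing ∷ X) = cong (nothing ∷_) (scale-identity X)
  scale-identity (just x ∷ X)  = cong₂ _∷_ (cong just (·-idˡ x)) (scale-identity X)

  scale-cancel : ∀ {n} c d (X : Vector F n) →
                 scale F (c · inv d) (scale F d X) ≡ scale F c X
  scale-cancel c d X = begin
    scale F (c · inv d) (scale F d X)  ≡⟨ scale-scale (c · inv d) d X ⟩
    scale F ((c · inv d) · d) X        ≡⟨ cong (λ u → scale F u X) c·d⁻¹·d≡c ⟩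
    scale F c X                        ∎
    where
    c·d⁻¹·d≡c : (c · inv d) · d ≡ c
    c·d⁻¹·d≡c = trans (·-assoc c (inv d) d)
                      (trans (cong (c ·_) (·-invˡ d)) (·-idʳ c))

  support-scale : ∀ {n} c (X : Vector F n) → support {F} (scale F c X) ≡ support {F} X
  support-scale c []            = refl
  support-scale c (nothing ∷ X) = cong (_ ∷_) (support-scale c X)
  support-scale c (just x ∷ X)  = cong (_ ∷_) (support-scale c X)

  innerSum-scale : ∀ {n} c d (X Y : Vector F n) →
                   innerSum F (scale F c X) (scale F d Y) ≡ L.map ((c · d) ·_) (innerSum F X Y)
  innerSum-scale c d []            []            = refl
  innerSum-scale c d (nothing ∷ X) (_ ∷ Y)       = innerSum-scale c d X Y
  innerSum-scale c d (just x ∷ X)  (nothing ∷ Y) = innerSum-scale c d X Y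
  innerSum-scale c d (just x ∷ X)  (just y ∷ Y)  =
    cong₂ L._∷_ (·-interchange c x d y) (innerSum-scale c d X Y)

  orthogonal-scale : ∀ {n} c d (X Y : Vector F n) → Orthogonal F X Y →
                     Orthogonal F (scale F c X) (scale F d Y)
  orthogonal-scale c d X Y X⊥Y =
    subst N (sym (innerSum-scale c d X Y)) (N-scale (c · d) _ X⊥Y)

module PushForward {F' F : Tract} (φ : TractHom F' F) where
  open TractHom φ
  open TractProperties F
  module F = Tract F
  open F using (_·_)

  applyᵛ : ∀ {n} → Vector F' n → Vector F n
  applyᵛ = V.map apply

  support-applyᵛ : ∀ {n} (X : Vector F' n) → support {F} (applyᵛ X) ≡ support {F'} X
  support-applyᵛ []            = refl
  support-applyᵛ (nothing ∷ X) = cong (_ ∷_) (support-applyᵛ X)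
  support-applyᵛ (just x ∷ X)  = cong (_ ∷_) (support-applyᵛ X)

  applyᵛ-scale : ∀ {n} d (X : Vector F' n) → applyᵛ (scale F' d X) ≡ scale F (f d) (applyᵛ X)
  applyᵛ-scale d []            = refl
  applyᵛ-scale d (nothing ∷ X) = cong (nothing ∷_) (applyᵛ-scale d X)
  applyᵛ-scale d (just x ∷ X)  = cong₂ _∷_ (cong just (f-mult d x)) (applyᵛ-scale d X)

  innerSum-applyᵛ : ∀ {n} (X Y : Vector F' n) →
                    innerSum F (applyᵛ X) (applyᵛ Y) ≡ L.map f (innerSum F' X Y)
  innerSum-applyᵛ []            []            = refl
  innerSum-applyᵛ (nothing ∷ X) (_ ∷ Y)       = innerSum-applyᵛ X Y
  innerSum-applyᵛ (just x ∷ X)  (nothing ∷ Y) = innerSum-applyᵛ X Y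
  innerSum-applyᵛ (just x ∷ X)  (just y ∷ Y)  =
    cong₂ L._∷_ (sym (f-mult x y)) (innerSum-applyᵛ X Y)

  orthogonal-applyᵛ : ∀ {n} (X Y : Vector F' n) → Orthogonal F' X Y →
                      Orthogonal F (applyᵛ X) (applyᵛ Y)
  orthogonal-applyᵛ X Y X⊥Y =
    subst F.N (sym (innerSum-applyᵛ X Y)) (f-N _ X⊥Y)

  -- PushCirc φ M' is definitionally Pushed (FMatroid.Circ M').
  Pushed : ∀ {n} → (Vector F' n → Set) → Vector F n → Set
  Pushed P Z = ∃[ c ] ∃[ X ] (P X × Z ≡ scale F c (applyᵛ X))

  module _ {n : ℕ} {P : Vector F' n → Set} where

    pushed-scale : ∀ c Z → Pushed P Z → Pushed P (scale F c Z)
    pushed-scale c _ (d , X , PX , refl) = c · d , X , PX , scale-scale c d (applyᵛ X)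

    support-pushed : ∀ c (X : Vector F' n) →
                     support {F} (scale F c (applyᵛ X)) ≡ support {F'} X
    support-pushed c X = trans (support-scale c (applyᵛ X)) (support-applyᵛ X)

    pushed-supp : (Q : Subset n → Set) → (∀ X → P X → Q (support {F'} X)) →
                  ∀ Z → Pushed P Z → Q (support {F} Z)
    pushed-supp Q supp _ (c , X , PX , refl) =
      subst Q (sym (support-pushed c X)) (supp X PX)

    pushed-exists : ∀ C → ∃[ X ] (P X × support {F'} X ≡ C) →
                    ∃[ Z ] (Pushed P Z × support {F} Z ≡ C)
    pushed-exists C (X , PX , suppX≡C) =
      scale F F.e (applyᵛ X) , (F.e , X , PX , refl) , trans (support-pushed F.e X) suppX≡C

    pushed-unique :
      (∀ X Y → P X → P Y → support {F'} X ≡ support {F'} Y → ∃[ d ] (Y ≡ scale F' d X)) →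
      ∀ Z W → Pushed P Z → Pushed P W → support {F} Z ≡ support {F} W →
      ∃[ k ] (W ≡ scale F k Z)
    pushed-unique unique _ _ (c₁ , X₁ , PX₁ , refl) (c₂ , X₂ , PX₂ , refl) suppZ≡suppW
      with unique X₁ X₂ PX₁ PX₂
             (trans (sym (support-pushed c₁ X₁)) (trans suppZ≡suppW (support-pushed c₂ X₂)))
    ... | d , refl = (c₂ · f d) · F.inv c₁ , (begin
      scale F c₂ (applyᵛ (scale F' d X₁))
        ≡⟨ cong (scale F c₂) (applyᵛ-scale d X₁) ⟩
      scale F c₂ (scale F (f d) (applyᵛ X₁))
        ≡⟨ scale-scale c₂ (f d) (applyᵛ X₁) ⟩
      scale F (c₂ · f d) (applyᵛ X₁)
        ≡⟨ sym (scale-cancel (c₂ · f d) c₁ (applyᵛ X₁)) ⟩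
      scale F ((c₂ · f d) · F.inv c₁) (scale F c₁ (applyᵛ X₁)) ∎)

    pushed-orthogonal : {Q : Vector F' n → Set} →
                        (∀ X Y → P X → Q Y → Orthogonal F' X Y) →
                        ∀ Z W → Pushed P Z → Pushed Q W → Orthogonal F Z W
    pushed-orthogonal orth _ _ (c , X , PX , refl) (d , Y , QY , refl) =
      orthogonal-scale c d (applyᵛ X) (applyᵛ Y) (orthogonal-applyᵛ X Y (orth X Y PX QY))

    covector-applyᵛ : ∀ X → CovectorOf F' P X → CovectorOf F (Pushed P) (applyᵛ X)
    covector-applyᵛ X cov _ (c , Y , PY , refl) =
      subst (λ R → Orthogonal F R (scale F c (applyᵛ Y)))
            (scale-identity (applyᵛ X))
            (orthogonal-scale F.e c (applyᵛ X) (applyᵛ Y)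
              (orthogonal-applyᵛ X Y (cov Y PY)))

  pushForward : ∀ {n} → FMatroid F' n → FMatroid F n
  pushForward M' = record
    { under         = under
    ; Circ          = Pushed Circ
    ; Cocirc        = Pushed Cocirc
    ; Circ-scale    = pushed-scale
    ; Cocirc-scale  = pushed-scale
    ; Circ-supp     = pushed-supp (IsCircuit under) Circ-supp
    ; Cocirc-supp   = pushed-supp (IsCocircuit under) Cocirc-supp
    ; Circ-exists   = λ C isC → pushed-exists C (Circ-exists C isC)
    ; Cocirc-exists = λ C isC → pushed-exists C (Cocirc-exists C isC)
    ; Circ-unique   = pushed-unique Circ-unique
    ; Cocirc-unique = pushed-unique Cocirc-unique
    ; orth          = pushed-orthogonal orth
    }
    where open FMatroid M'

  lift-covectors-push : ∀ {m n} (A' : Matrix F' m n) (M' : FMatroid F' n) →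
                        (∀ i → IsCovector M' (lookup A' i)) →
                        ∀ i → IsPushCovector φ M' (lookup (V.map applyᵛ A') i)
  lift-covectors-push A' M' cov i rewrite lookup-map i applyᵛ A' =
    covector-applyᵛ (lookup A' i) (cov i)

proposition4p4 : (F' F : Tract) (φ : TractHom F' F) (m n : ℕ) (A : Matrix F m n) →
    ((r : ℕ) → LiftRankAttained φ A r → Σ ℕ λ r' → r' ≤ r × PhiMatRankAttained φ A r')
    × ((r : ℕ) → PhiMatRankAttained φ A r → Σ ℕ λ r' → r' ≤ r × MatRankAttained {F} A r')
proposition4p4 F' F φ m n A = liftRank≥φRank , φRank≥matRank
  where
  open PushForward φ

  liftRank≥φRank : (r : ℕ) → LiftRankAttained φ A r →
                   Σ ℕ λ r' → r' ≤ r × PhiMatRankAttained φ A r'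
  liftRank≥φRank r (A' , refl , M' , rank , cov) =
    r , ≤-refl , M' , rank , lift-covectors-push A' M' cov

  φRank≥matRank : (r : ℕ) → PhiMatRankAttained φ A r →
                  Σ ℕ λ r' → r' ≤ r × MatRankAttained {F} A r'
  φRank≥matRank r (M' , rank , cov) = r , ≤-refl , pushForward M' , rank , cov
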